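{- Let $\alpha$ be a strong composition such that $\kappa_\alpha$ is not multiplicity free, and let $a$ be a weak composition with $\mathrm{flat}(a)=\alpha$. Then $\kappa_a$ is not multiplicity free.
   Context: A weak composition $a=(a_1,\dots,a_\ell)$ of length $\ell$ is a finite sequence of nonnegative integers; a strong composition is one whose parts are all positive; $\mathrm{flat}(a)$ is obtained from $a$ by deleting its zeros. A diagram is a finite set of cells $(r,c)$ with $r,c$ positive integers (row $r$ from the bottom, column $c$ from the left). A Kohnert tableau of content $a$ is a diagram filled with positive integers, exactly $a_i$ cells containing $i$ for each $i$, such that: (i) for each $i$ there is exactly one $i$ in each of the columns $1,\dots,a_i$; (ii) every entry in row $r$ is at least $r$; (iii) for each $i$, the cells containing $i$ weakly descend from left to right; (iv) if $i<j$ appear in the same column with $i$ above $j$, then there is an $i$ in the column immediately to the right of the cell containing that $j$, in a row strictly above it. It is quasi-Yamanouchi if moreover (v) for each nonempty row $r$, either row $r$ contains an entry equal to $r$, or some cell of row $r+1$ lies weakly to the right of some cell of row $r$. Let $\mathrm{QKT}(a)$ be the set of quasi-Yamanouchi Kohnert tableaux of content $a$, and $\mathrm{wt}(T)$ the weak composition of length $\ell$ whose $r$-th part is the number of cells in row $r$ of $T$. The key polynomial $\kappa_a$ satisfies $\kappa_a=\sum_{T\in\mathrm{QKT}(a)}\mathfrak{F}_{\mathrm{wt}(T)}$, where $\mathfrak{F}_b$ is the fundamental slide polynomial. We say $\kappa_a$ is multiplicity free if distinct tableaux in $\mathrm{QKT}(a)$ have distinct weights. -}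

module Defs where

open import Data.Nat using (ℕ; zero; suc; _≤_; _<_; _≡ᵇ_)
open import Data.Bool using (if_then_else_)
open import Data.Fin using (Fin; toℕ)
open import Data.List using (List; []; _∷_; length; lookup; map; allFin)
open import Data.Nat.ListAction using (sum)
open import Data.List.Relation.Unary.All using (All)
open import Data.Vec using (Vec; tabulate)
open import Data.Product using (Σ; _×_; ∃)
open import Data.Sum using (_⊎_)
open import Relation.Binary.PropositionalEquality using (_≡_)
open import Relation.Nullary using (¬_)

WeakComp : Set
WeakComp = List ℕ

StrongComp : List ℕ → Set
StrongComp α = All (λ x → 0 < x) α

flat : List ℕ → List ℕ
flat [] = []
flat (zero ∷ a) = flat a
flat (suc x ∷ a) = suc x ∷ flat a

-- Entry values i ∈ {1..ℓ} are indexed by Fin ℓ (value = toℕ i + 1);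
-- column c ∈ {1..a_i} by Fin a_i (column = toℕ c + 1).
val : ∀ {n} → Fin n → ℕ
val i = suc (toℕ i)

-- A filling satisfying condition (i) is determined by the row of the unique
-- cell holding entry i in column c (for c ≤ a_i).  Rows are 1-indexed naturals.
Filling : WeakComp → Set
Filling a = (i : Fin (length a)) → Fin (lookup a i) → ℕ

-- Kohnert tableau of content a (conditions (i)-(iv)); (i) is built into Filling.
record IsKohnert (a : WeakComp) (T : Filling a) : Set where
  field
    rowPos   : ∀ i c → 1 ≤ T i c
    -- distinct (entry,column) pairs occupy distinct cells (it is a filling of a set of cells)
    cellsDistinct : ∀ i j (c : Fin (lookup a i)) (d : Fin (lookup a j)) →
                    toℕ c ≡ toℕ d → T i c ≡ T j d → i ≡ j
    -- (ii) every entry in row r is at least r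
    rowBound : ∀ i c → T i c ≤ val i
    descend  : ∀ i (c c' : Fin (lookup a i)) → toℕ c < toℕ c' → T i c' ≤ T i c
    kohnert  : ∀ i j (c : Fin (lookup a i)) (d : Fin (lookup a j)) →
               toℕ i < toℕ j → toℕ c ≡ toℕ d → T j d < T i c →
               Σ (Fin (lookup a i)) λ e → (toℕ e ≡ suc (toℕ d)) × (T j d < T i e)

RowNonempty : (a : WeakComp) → Filling a → ℕ → Set
RowNonempty a T r = Σ (Fin (length a)) λ i → Σ (Fin (lookup a i)) λ c → T i c ≡ r

record IsQKT (a : WeakComp) (T : Filling a) : Set where
  field
    kohnertT : IsKohnert a T
    quasiYam : ∀ r → RowNonempty a T r →
      (Σ (Fin (length a)) λ i → Σ (Fin (lookup a i)) λ c → (T i c ≡ r) × (val i ≡ r))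
      ⊎
      (Σ (Fin (length a)) λ i → Σ (Fin (lookup a i)) λ c →
       Σ (Fin (length a)) λ j → Σ (Fin (lookup a j)) λ d →
         (T i c ≡ r) × (T j d ≡ suc r) × (toℕ c ≤ toℕ d))

rowCount : (a : WeakComp) → Filling a → ℕ → ℕ
rowCount a T r = sum (map (λ i → sum (map (λ c → if T i c ≡ᵇ r then 1 else 0)
                                          (allFin (lookup a i))))
                          (allFin (length a)))

wt : (a : WeakComp) → Filling a → Vec ℕ (length a)
wt a T = tabulate (λ r → rowCount a T (val r))

MultiplicityFree : WeakComp → Set
MultiplicityFree a = (T₁ T₂ : Filling a) → IsQKT a T₁ → IsQKT a T₂ →
  wt a T₁ ≡ wt a T₂ → ∀ i c → T₁ i c ≡ T₂ i c

-- A Kohnert tableau T of content flat a lifts to one of content a: the entry k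
-- becomes the index of the k-th nonzero part of a, and a cell in row r moves to
-- row spread a r, the index of the r-th nonzero part.  The lift is injective,
-- its weight is determined by the weight of T, and it is quasi-Yamanouchi,
-- because in a tableau of a strong composition the entry k sits in row k of
-- column 1.  So two distinct QKTs of flat a of equal weight lift to two distinct
-- QKTs of a of equal weight.
module Submission where

open import Defs
open import Data.Nat using (ℕ; zero; suc; _+_; _≤_; _<_; _≡ᵇ_; z≤n; s≤s; z<s; s<s; s<s⁻¹)
open import Data.Nat.Properties
  using (≤-refl; ≤-trans; ≤-reflexive; ≤-antisym; <⇒≤; <⇒≱; ≮⇒≥; ≰⇒>; <-irrefl; n<1+n;
         ≤-<-trans; m≤n⇒m<n∨m≡n; _≟_)
open import Data.Bool using (if_then_else_)
open import Data.Fin using (Fin; zero; suc; toℕ; cast; fromℕ<)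
open import Data.Fin.Properties using (toℕ-cast; toℕ-injective; toℕ<n; toℕ-fromℕ<; cast-is-id; any?)
open import Data.Fin.Induction using (<-wellFounded)
open import Data.List using (List; []; _∷_; length; lookup; map; allFin)
open import Data.List.Properties using (map-cong; map-tabulate)
open import Data.List.Membership.Propositional.Properties using (∈-lookup)
open import Data.List.Relation.Unary.All as All using (_∷_)
open import Data.Nat.ListAction using (sum)
import Data.Vec as Vec
open import Data.Vec.Properties using (lookup∘tabulate; tabulate-cong)
open import Data.Product using (Σ; ∃-syntax; _×_; _,_)
open import Data.Sum using (inj₁; inj₂)
open import Data.Empty using (⊥-elim)
open import Function using (_∘_; Injective)
open import Function.Bundles using (mk⇔)
open import Induction.WellFounded using (module All)
open import Relation.Binary.PropositionalEquality
open import Relation.Nullary using (¬_; yes; no)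
open import Relation.Nullary.Decidable using (dec-false; does-⇔)

partIndex : (a : List ℕ) → Fin (length (flat a)) → Fin (length a)
partIndex (zero ∷ a) k = suc (partIndex a k)
partIndex (suc x ∷ a) zero = zero
partIndex (suc x ∷ a) (suc k) = suc (partIndex a k)

lookup-flat : (a : List ℕ) (k : Fin (length (flat a))) → lookup (flat a) k ≡ lookup a (partIndex a k)
lookup-flat (zero ∷ a) k = lookup-flat a k
lookup-flat (suc x ∷ a) zero = refl
lookup-flat (suc x ∷ a) (suc k) = lookup-flat a k

-- The column c only witnesses that the part j is nonzero.
flatIndex : (a : List ℕ) (j : Fin (length a)) → Fin (lookup a j) → Fin (length (flat a))
flatIndex (zero ∷ a) zero ()
flatIndex (zero ∷ a) (suc j) c = flatIndex a j c
flatIndex (suc x ∷ a) zero c = zero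
flatIndex (suc x ∷ a) (suc j) c = suc (flatIndex a j c)

lookup-flatIndex : (a : List ℕ) (j : Fin (length a)) (c : Fin (lookup a j)) →
                   lookup (flat a) (flatIndex a j c) ≡ lookup a j
lookup-flatIndex (zero ∷ a) zero ()
lookup-flatIndex (zero ∷ a) (suc j) c = lookup-flatIndex a j c
lookup-flatIndex (suc x ∷ a) zero c = refl
lookup-flatIndex (suc x ∷ a) (suc j) c = lookup-flatIndex a j c

partIndex-flatIndex : (a : List ℕ) (j : Fin (length a)) (c : Fin (lookup a j)) → partIndex a (flatIndex a j c) ≡ j
partIndex-flatIndex (zero ∷ a) zero ()
partIndex-flatIndex (zero ∷ a) (suc j) c = cong suc (partIndex-flatIndex a j c)
partIndex-flatIndex (suc x ∷ a) zero c = refl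
partIndex-flatIndex (suc x ∷ a) (suc j) c = cong suc (partIndex-flatIndex a j c)

flatIndex-partIndex : (a : List ℕ) (k : Fin (length (flat a))) (c : Fin (lookup a (partIndex a k))) →
                      flatIndex a (partIndex a k) c ≡ k
flatIndex-partIndex (zero ∷ a) k c = flatIndex-partIndex a k c
flatIndex-partIndex (suc x ∷ a) zero c = refl
flatIndex-partIndex (suc x ∷ a) (suc k) c = cong suc (flatIndex-partIndex a k c)

flatIndex-irrelevant : (a : List ℕ) (j : Fin (length a)) (c d : Fin (lookup a j)) → flatIndex a j c ≡ flatIndex a j d
flatIndex-irrelevant (zero ∷ a) zero ()
flatIndex-irrelevant (zero ∷ a) (suc j) c d = flatIndex-irrelevant a j c d
flatIndex-irrelevant (suc x ∷ a) zero c d = refl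
flatIndex-irrelevant (suc x ∷ a) (suc j) c d = cong suc (flatIndex-irrelevant a j c d)

flatIndex-injective : (a : List ℕ) {i j : Fin (length a)} (c : Fin (lookup a i)) (d : Fin (lookup a j)) →
                      flatIndex a i c ≡ flatIndex a j d → i ≡ j
flatIndex-injective a {i} {j} c d eq = begin
  i                             ≡⟨ partIndex-flatIndex a i c ⟨
  partIndex a (flatIndex a i c) ≡⟨ cong (partIndex a) eq ⟩
  partIndex a (flatIndex a j d) ≡⟨ partIndex-flatIndex a j d ⟩
  j                             ∎
  where open ≡-Reasoning

flat-strong : (a : List ℕ) → StrongComp (flat a)
flat-strong [] = All.[]
flat-strong (zero ∷ a) = flat-strong a
flat-strong (suc x ∷ a) = z<s ∷ flat-strong a

spread : List ℕ → ℕ → ℕ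
spread [] r = r
spread (zero ∷ a) zero = zero
spread (zero ∷ a) (suc r) = suc (spread a (suc r))
spread (suc x ∷ a) zero = zero
spread (suc x ∷ a) (suc r) = suc (spread a r)

spread-zero : (a : List ℕ) → spread a 0 ≡ 0
spread-zero [] = refl
spread-zero (zero ∷ a) = refl
spread-zero (suc x ∷ a) = refl

spread-mono-< : (a : List ℕ) {r s : ℕ} → r < s → spread a r < spread a s
spread-mono-< [] lt = lt
spread-mono-< (zero ∷ a) {zero} {suc s} lt = z<s
spread-mono-< (zero ∷ a) {suc r} {suc s} lt = s<s (spread-mono-< a lt)
spread-mono-< (suc x ∷ a) {zero} {suc s} lt = z<s
spread-mono-< (suc x ∷ a) {suc r} {suc s} (s<s lt) = s<s (spread-mono-< a lt)

spread-mono-≤ : (a : List ℕ) {r s : ℕ} → r ≤ s → spread a r ≤ spread a s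
spread-mono-≤ a le with m≤n⇒m<n∨m≡n le
... | inj₁ lt = <⇒≤ (spread-mono-< a lt)
... | inj₂ refl = ≤-refl

spread-cancel-< : (a : List ℕ) {r s : ℕ} → spread a r < spread a s → r < s
spread-cancel-< a lt = ≰⇒> (λ s≤r → <⇒≱ lt (spread-mono-≤ a s≤r))

spread-cancel-≤ : (a : List ℕ) {r s : ℕ} → spread a r ≤ spread a s → r ≤ s
spread-cancel-≤ a le = ≮⇒≥ (λ s<r → <⇒≱ (spread-mono-< a s<r) le)

spread-injective : (a : List ℕ) → Injective _≡_ _≡_ (spread a)
spread-injective a eq = ≤-antisym (spread-cancel-≤ a (≤-reflexive eq)) (spread-cancel-≤ a (≤-reflexive (sym eq)))

spread-inflationary : (a : List ℕ) (r : ℕ) → r ≤ spread a r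
spread-inflationary a zero = z≤n
spread-inflationary a (suc r) = ≤-<-trans (spread-inflationary a r) (spread-mono-< a (n<1+n r))

spread-val : (a : List ℕ) (k : Fin (length (flat a))) → spread a (val k) ≡ val (partIndex a k)
spread-val (zero ∷ a) k = cong suc (spread-val a k)
spread-val (suc x ∷ a) zero = cong suc (spread-zero a)
spread-val (suc x ∷ a) (suc k) = cong suc (spread-val a k)

spread-val-flatIndex : (a : List ℕ) (j : Fin (length a)) (c : Fin (lookup a j)) →
                       spread a (val (flatIndex a j c)) ≡ val j
spread-val-flatIndex a j c = trans (spread-val a _) (cong val (partIndex-flatIndex a j c))

flatIndex-mono-< : (a : List ℕ) {i j : Fin (length a)} (c : Fin (lookup a i)) (d : Fin (lookup a j)) →
                   toℕ i < toℕ j → toℕ (flatIndex a i c) < toℕ (flatIndex a j d)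
flatIndex-mono-< a c d i<j =
  s<s⁻¹ (spread-cancel-< a (subst₂ _<_ (sym (spread-val-flatIndex a _ c)) (sym (spread-val-flatIndex a _ d)) (s<s i<j)))

val-surjective : ∀ {n} (s : ℕ) → 1 ≤ s → s ≤ n → ∃[ k ] val {n} k ≡ s
val-surjective (suc s) _ s<n = fromℕ< s<n , cong suc (toℕ-fromℕ< s<n)

filling-cong : ∀ {b} (T : Filling b) {k k'} → k ≡ k' → (c : Fin (lookup b k)) (d : Fin (lookup b k')) →
               toℕ c ≡ toℕ d → T k c ≡ T k' d
filling-cong T refl c d eq = cong (T _) (toℕ-injective eq)

kohnert-rowIndex : ∀ {b} {T : Filling b} → IsKohnert b T → ∀ i c → ∃[ k ] val k ≡ T i c
kohnert-rowIndex K i c = val-surjective _ (rowPos i c) (≤-trans (rowBound i c) (toℕ<n i))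
  where open IsKohnert K

firstColumn : ∀ {b} → StrongComp b → (k : Fin (length b)) → Fin (lookup b k)
firstColumn strong k = fromℕ< (All.lookup strong (∈-lookup k))

-- Rows 1, …, k - 1 of column 1 are already taken by the entries 1, …, k - 1.
firstColumn-row : ∀ {b} (strong : StrongComp b) {T : Filling b} → IsKohnert b T →
                  ∀ k → T k (firstColumn strong k) ≡ val k
firstColumn-row {b} strong {T} K = All.wfRec <-wellFounded _ _ step
  where
  open IsKohnert K
  column₁ : (k : Fin (length b)) → Fin (lookup b k)
  column₁ = firstColumn strong
  step : ∀ k → (∀ {j} → toℕ j < toℕ k → T j (column₁ j) ≡ val j) → T k (column₁ k) ≡ val k
  step k ih with m≤n⇒m<n∨m≡n (rowBound k (column₁ k))
  ... | inj₂ onRow = onRow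
  ... | inj₁ below with kohnert-rowIndex K k (column₁ k)
  ...   | j , valj = ⊥-elim (<-irrefl (cong toℕ (sym k≡j)) j<k)
    where
    j<k : toℕ j < toℕ k
    j<k = s<s⁻¹ (subst (_< val k) (sym valj) below)
    k≡j : k ≡ j
    k≡j = cellsDistinct k j (column₁ k) (column₁ j) (trans (toℕ-fromℕ< _) (sym (toℕ-fromℕ< _)))
                        (trans (sym valj) (sym (ih j<k)))

lift : (a : List ℕ) → Filling (flat a) → Filling a
lift a T j c = spread a (T (flatIndex a j c) (cast (sym (lookup-flatIndex a j c)) c))

module _ (a : List ℕ) (T : Filling (flat a)) where

  lift-≡ : ∀ {j} (c : Fin (lookup a j)) {k} (d : Fin (lookup (flat a) k)) →
           flatIndex a j c ≡ k → toℕ c ≡ toℕ d → lift a T j c ≡ spread a (T k d)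
  lift-≡ c d eq c≈d = cong (spread a) (filling-cong {flat a} T eq _ d (trans (toℕ-cast _ c) c≈d))

  lift-partIndex : ∀ k (c : Fin (lookup (flat a) k)) →
                   lift a T (partIndex a k) (cast (lookup-flat a k) c) ≡ spread a (T k c)
  lift-partIndex k c = lift-≡ _ c (flatIndex-partIndex a k _) (toℕ-cast _ c)

module _ (a : List ℕ) {T : Filling (flat a)} (K : IsKohnert (flat a) T) where
  open IsKohnert K

  private
    column : ∀ j (c : Fin (lookup a j)) → Fin (lookup a j) → Fin (lookup (flat a) (flatIndex a j c))
    column j c = cast (sym (lookup-flatIndex a j c))

    lift-column : ∀ j (c c' : Fin (lookup a j)) → lift a T j c' ≡ spread a (T (flatIndex a j c) (column j c c'))
    lift-column j c c' = lift-≡ a T c' _ (flatIndex-irrelevant a j c' c) (sym (toℕ-cast _ c'))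

  lift-kohnert : ∀ i j (c : Fin (lookup a i)) (d : Fin (lookup a j)) →
                 toℕ i < toℕ j → toℕ c ≡ toℕ d → lift a T j d < lift a T i c →
                 Σ (Fin (lookup a i)) λ e → (toℕ e ≡ suc (toℕ d)) × (lift a T j d < lift a T i e)
  lift-kohnert i j c d i<j c≈d below
    with kohnert _ _ (column i c c) (column j d d) (flatIndex-mono-< a c d i<j)
                 (trans (toℕ-cast _ c) (trans c≈d (sym (toℕ-cast _ d))))
                 (spread-cancel-< a below)
  ... | e , e≈d+1 , above =
    cast (lookup-flatIndex a i c) e ,
    trans (toℕ-cast _ e) (trans e≈d+1 (cong suc (toℕ-cast _ d))) ,
    subst (lift a T j d <_) (sym (lift-≡ a T _ e (flatIndex-irrelevant a i _ c) (toℕ-cast _ e)))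
          (spread-mono-< a above)

  lift-isKohnert : IsKohnert a (lift a T)
  lift-isKohnert = record
    { rowPos = λ j c → ≤-trans (rowPos _ _) (spread-inflationary a _)
    ; cellsDistinct = λ i j c d c≈d sameRow →
        flatIndex-injective a c d
          (cellsDistinct _ _ _ _ (trans (toℕ-cast _ c) (trans c≈d (sym (toℕ-cast _ d))))
                         (spread-injective a sameRow))
    ; rowBound = λ j c → ≤-trans (spread-mono-≤ a (rowBound _ _)) (≤-reflexive (spread-val-flatIndex a j c))
    ; descend = λ j c c' c<c' →
        subst (_≤ lift a T j c) (sym (lift-column j c c'))
              (spread-mono-≤ a (descend _ (column j c c) _
                (subst₂ _<_ (sym (toℕ-cast _ c)) (sym (toℕ-cast _ c')) c<c')))
    ; kohnert = lift-kohnert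
    }

  lift-rowContainsRowIndex : ∀ r → RowNonempty a (lift a T) r →
                             Σ (Fin (length a)) λ i → Σ (Fin (lookup a i)) λ c → (lift a T i c ≡ r) × (val i ≡ r)
  lift-rowContainsRowIndex r (j , c , onRow) with kohnert-rowIndex K _ (column j c c)
  ... | k , valk =
    partIndex a k , cast (lookup-flat a k) (firstColumn strong k) ,
    trans (lift-partIndex a T k _) (trans (cong (spread a) (firstColumn-row strong K k)) spread-valk) ,
    trans (sym (spread-val a k)) spread-valk
    where
    strong : StrongComp (flat a)
    strong = flat-strong a
    spread-valk : spread a (val k) ≡ r
    spread-valk = trans (cong (spread a) valk) onRow

  lift-isQKT : IsQKT a (lift a T)
  lift-isQKT = record { kohnertT = lift-isKohnert ; quasiYam = λ r → inj₁ ∘ lift-rowContainsRowIndex r }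

∑entryCells : (b : List ℕ) → ((i : Fin (length b)) → Fin (lookup b i) → ℕ) → Fin (length b) → ℕ
∑entryCells b f i = sum (map (f i) (allFin (lookup b i)))

∑cells : (b : List ℕ) → ((i : Fin (length b)) → Fin (lookup b i) → ℕ) → ℕ
∑cells b f = sum (map (∑entryCells b f) (allFin (length b)))

map-allFin-suc : ∀ {A : Set} {n} (f : Fin (suc n) → A) → map f (allFin (suc n)) ≡ f zero ∷ map (f ∘ suc) (allFin n)
map-allFin-suc f = cong (f zero ∷_) (trans (map-tabulate suc f) (sym (map-tabulate (λ i → i) (f ∘ suc))))

sum-map-≡0 : ∀ {A : Set} {f : A → ℕ} → (∀ x → f x ≡ 0) → (xs : List A) → sum (map f xs) ≡ 0
sum-map-≡0 f≡0 [] = refl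
sum-map-≡0 f≡0 (x ∷ xs) = cong₂ _+_ (f≡0 x) (sum-map-≡0 f≡0 xs)

∑cells-cong : ∀ b {f g : (i : Fin (length b)) → Fin (lookup b i) → ℕ} →
              (∀ i c → f i c ≡ g i c) → ∑cells b f ≡ ∑cells b g
∑cells-cong b f≡g =
  cong sum (map-cong (λ i → cong sum (map-cong (f≡g i) (allFin (lookup b i)))) (allFin (length b)))

∑cells-flat : ∀ a (f : (j : Fin (length a)) → Fin (lookup a j) → ℕ) →
              ∑cells a f ≡ ∑cells (flat a) (λ k c → f (partIndex a k) (cast (lookup-flat a k) c))
∑cells-flat [] f = refl
∑cells-flat (zero ∷ a) f = trans (cong sum (map-allFin-suc (∑entryCells (zero ∷ a) f))) (∑cells-flat a (f ∘ suc))
∑cells-flat (suc x ∷ a) f = begin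
  ∑cells (suc x ∷ a) f
    ≡⟨ cong sum (map-allFin-suc (∑entryCells (suc x ∷ a) f)) ⟩
  sum (map (f zero) (allFin (suc x))) + ∑cells a (f ∘ suc)
    ≡⟨ cong₂ _+_ (cong sum (map-cong (λ c → cong (f zero) (sym (cast-is-id refl c))) (allFin (suc x))))
                 (∑cells-flat a (f ∘ suc)) ⟩
  sum (map (f zero ∘ cast refl) (allFin (suc x))) + ∑cells (flat a) (λ k → f' (suc k))
    ≡⟨ cong sum (map-allFin-suc (∑entryCells (flat (suc x ∷ a)) f')) ⟨
  ∑cells (flat (suc x ∷ a)) f' ∎
  where
  open ≡-Reasoning
  f' : (k : Fin (length (flat (suc x ∷ a)))) → Fin (lookup (flat (suc x ∷ a)) k) → ℕ
  f' k c = f (partIndex (suc x ∷ a) k) (cast (lookup-flat (suc x ∷ a) k) c)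

-- rowCount b T r is ∑cells b of the indicator of row r, and (x ≡ᵇ r) is does (x ≟ r).
rowCount-empty : ∀ b (T : Filling b) r → (∀ i c → T i c ≢ r) → rowCount b T r ≡ 0
rowCount-empty b T r empty =
  sum-map-≡0 (λ i → sum-map-≡0 (λ c → cong (if_then 1 else 0) (dec-false (T i c ≟ r) (empty i c)))
                               (allFin (lookup b i)))
             (allFin (length b))

rowCount-preimage : ∀ b (T : Filling b) {g : ℕ → ℕ} → Injective _≡_ _≡_ g → ∀ {s r} → g s ≡ r →
                    rowCount b (λ i c → g (T i c)) r ≡ rowCount b T s
rowCount-preimage b T {g} g-inj {s} {r} gs≡r = ∑cells-cong b λ i c →
  cong (if_then 1 else 0)
       (does-⇔ (mk⇔ (λ eq → g-inj (trans eq (sym gs≡r))) (λ eq → trans (cong g eq) gs≡r))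
               (g (T i c) ≟ r) (T i c ≟ s))

rowCount-map : ∀ b (T₁ T₂ : Filling b) {g : ℕ → ℕ} → Injective _≡_ _≡_ g → (∀ s → s ≤ g s) →
               (∀ s → rowCount b T₁ s ≡ rowCount b T₂ s) →
               ∀ r → rowCount b (λ i c → g (T₁ i c)) r ≡ rowCount b (λ i c → g (T₂ i c)) r
rowCount-map b T₁ T₂ {g} g-inj g-infl same r with any? (λ (s : Fin (suc r)) → g (toℕ s) ≟ r)
... | yes (s , gs≡r) =
  trans (rowCount-preimage b T₁ g-inj gs≡r) (trans (same (toℕ s)) (sym (rowCount-preimage b T₂ g-inj gs≡r)))
... | no noPreimage = trans (outside T₁) (sym (outside T₂))
  where
  outside : ∀ T → rowCount b (λ i c → g (T i c)) r ≡ 0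
  outside T = rowCount-empty b _ r λ i c gT≡r →
    noPreimage (fromℕ< (s≤s (≤-trans (g-infl _) (≤-reflexive gT≡r))) , trans (cong g (toℕ-fromℕ< _)) gT≡r)

wt-rowCount : ∀ b {T₁ T₂ : Filling b} → IsKohnert b T₁ → IsKohnert b T₂ → wt b T₁ ≡ wt b T₂ →
              ∀ s → rowCount b T₁ s ≡ rowCount b T₂ s
wt-rowCount b {T₁} {T₂} K₁ K₂ W s with any? (λ k → val k ≟ s)
... | yes (k , valk) = subst (λ s → rowCount b T₁ s ≡ rowCount b T₂ s) valk
  (trans (sym (lookup∘tabulate _ k)) (trans (cong (λ w → Vec.lookup w k) W) (lookup∘tabulate _ k)))
... | no notRow = trans (outside K₁) (sym (outside K₂))
  where
  outside : ∀ {T} → IsKohnert b T → rowCount b T s ≡ 0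
  outside K = rowCount-empty b _ s λ i c onRow →
    let (k , valk) = kohnert-rowIndex K i c in notRow (k , trans valk onRow)

rowCount-lift : ∀ a (T : Filling (flat a)) r →
                rowCount a (lift a T) r ≡ rowCount (flat a) (λ k c → spread a (T k c)) r
rowCount-lift a T r = trans (∑cells-flat a _)
  (∑cells-cong (flat a) λ k c → cong (λ x → if x ≡ᵇ r then 1 else 0) (lift-partIndex a T k c))

lift-wt : ∀ a {T₁ T₂ : Filling (flat a)} → IsKohnert (flat a) T₁ → IsKohnert (flat a) T₂ →
          wt (flat a) T₁ ≡ wt (flat a) T₂ → wt a (lift a T₁) ≡ wt a (lift a T₂)
lift-wt a {T₁} {T₂} K₁ K₂ W = tabulate-cong λ r → begin
  rowCount a (lift a T₁) (val r)
    ≡⟨ rowCount-lift a T₁ (val r) ⟩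
  rowCount (flat a) (λ k c → spread a (T₁ k c)) (val r)
    ≡⟨ rowCount-map (flat a) T₁ T₂ (spread-injective a) (spread-inflationary a)
                    (wt-rowCount (flat a) K₁ K₂ W) (val r) ⟩
  rowCount (flat a) (λ k c → spread a (T₂ k c)) (val r)
    ≡⟨ rowCount-lift a T₂ (val r) ⟨
  rowCount a (lift a T₂) (val r) ∎
  where open ≡-Reasoning

multiplicityFree-flat : ∀ a → MultiplicityFree a → MultiplicityFree (flat a)
multiplicityFree-flat a mf T₁ T₂ Q₁ Q₂ W k c = spread-injective a (begin
  spread a (T₁ k c)
    ≡⟨ lift-partIndex a T₁ k c ⟨
  lift a T₁ (partIndex a k) c'
    ≡⟨ mf (lift a T₁) (lift a T₂) (lift-isQKT a K₁) (lift-isQKT a K₂) (lift-wt a K₁ K₂ W) _ c' ⟩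
  lift a T₂ (partIndex a k) c'
    ≡⟨ lift-partIndex a T₂ k c ⟩
  spread a (T₂ k c) ∎)
  where
  open ≡-Reasoning
  K₁ : IsKohnert (flat a) T₁
  K₁ = IsQKT.kohnertT Q₁
  K₂ : IsKohnert (flat a) T₂
  K₂ = IsQKT.kohnertT Q₂
  c' : Fin (lookup a (partIndex a k))
  c' = cast (lookup-flat a k) c

-- The strong-composition hypothesis is redundant: flat a is always strong.
lemma5p1 : (α a : List ℕ) → StrongComp α → ¬ MultiplicityFree α →
           flat a ≡ α → ¬ MultiplicityFree a
lemma5p1 .(flat a) a _ ¬mf refl = ¬mf ∘ multiplicityFree-flat a
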